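{- For every instance $(G,\Omega,\Phi,K)$, where $G=(V,E)$ is a finite undirected graph and $\Omega,\Phi,K$ are non-negative integers with $\Omega+\Phi\le |V|$, the following two decision problems have the same answer: (Vaccination-Attack) Is there $D\subseteq V$ with $|D|\le\Omega$ such that for every $I\subseteq V\setminus D$ with $|I|\le\Phi$, $\mathrm{inf}(D,I)\le K$? (MinMax$\Phi$C) Is there $D\subseteq V$ with $|D|\le \Omega$ such that the sum of the sizes of the $\Phi$ largest connected components of $G[V\setminus D]$ (all components, if there are fewer than $\Phi$) is at most $K$?
   Context: For $D\subseteq V$ and $I\subseteq V\setminus D$, $\mathrm{inf}(D,I)$ denotes the total number of vertices lying in connected components of $G[V\setminus D]$ (the subgraph induced by $V\setminus D$) that contain at least one vertex of $I$ (the infected vertices when $D$ is vaccinated and $I$ attacked). -}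

module Defs where

open import Data.Nat using (ℕ; _≤_; _+_)
open import Data.Bool using (Bool; true; false)
open import Data.Fin using (Fin)
open import Data.Fin.Subset using (Subset; _∈_; _∉_; _⊆_; ∁; ∣_∣)
open import Data.List using (List; take; map)
open import Data.Nat.ListAction using (sum)
open import Data.List.Relation.Unary.Linked using (Linked)
open import Data.List.Relation.Unary.Unique.Propositional using (Unique)
open import Data.List.Membership.Propositional using () renaming (_∈_ to _∈ₗ_)
open import Data.Product using (Σ; _×_; ∃)
open import Function.Bundles using (_⇔_)
open import Relation.Binary.PropositionalEquality using (_≡_)

record Graph (n : ℕ) : Set where
  field
    adj        : Fin n → Fin n → Bool
    adj-sym    : ∀ u v → adj u v ≡ adj v u
    adj-irrefl : ∀ u → adj u u ≡ false
open Graph public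

module _ {n : ℕ} (G : Graph n) where

  data Conn (D : Subset n) (u : Fin n) : Fin n → Set where
    here : u ∉ D → Conn D u u
    step : ∀ {v w} → Conn D u v → adj G v w ≡ true → w ∉ D → Conn D u w

  Infected : Subset n → Subset n → Fin n → Set
  Infected D I v = Σ (Fin n) λ i → i ∈ I × Conn D i v

  IsInfSet : Subset n → Subset n → Subset n → Set
  IsInfSet D I S = ∀ v → (v ∈ S ⇔ Infected D I v)

  -- inf(D, I) ≤ K   (the infected set is unique, so this says its size is ≤ K)
  InfAtMost : Subset n → Subset n → ℕ → Set
  InfAtMost D I K = ∀ S → IsInfSet D I S → ∣ S ∣ ≤ K

  IsComponent : Subset n → Subset n → Set
  IsComponent D C = Σ (Fin n) λ u → u ∉ D × (∀ v → (v ∈ C ⇔ Conn D u v))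

  IsSortedComponentList : Subset n → List (Subset n) → Set
  IsSortedComponentList D L =
    Unique L
    × (∀ C → (C ∈ₗ L ⇔ IsComponent D C))
    × Linked (λ A B → ∣ B ∣ ≤ ∣ A ∣) L

  TopSumAtMost : Subset n → ℕ → ℕ → Set
  TopSumAtMost D Φ K =
    ∀ L → IsSortedComponentList D L → sum (map ∣_∣ (take Φ L)) ≤ K

  VaccinationAttack : ℕ → ℕ → ℕ → Set
  VaccinationAttack Ω Φ K =
    Σ (Subset n) λ D → ∣ D ∣ ≤ Ω ×
      (∀ I → I ⊆ ∁ D → ∣ I ∣ ≤ Φ → InfAtMost D I K)

  MinMaxΦC : ℕ → ℕ → ℕ → Set
  MinMaxΦC Ω Φ K =
    Σ (Subset n) λ D → ∣ D ∣ ≤ Ω × TopSumAtMost D Φ K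

module Submission where

-- Fix the vaccinated set D; the two problems then ask the same
-- question about G[V ∖ D]:
--   "every attack I with |I| ≤ Φ infects at most K vertices"
--   ⇔ "the Φ largest components of G[V ∖ D] have total size at most K".
-- (⇒) Choose one vertex in each of the Φ largest components: the infected set
--     of this attack is exactly the union of those components, and distinct
--     components are disjoint, so its size is the sum of their sizes.
-- (⇐) An attack I infects exactly the components meeting I; there are at most
--     |I| ≤ Φ of them (they meet I in disjoint nonempty sets), and any at most
--     Φ entries of a non-increasing list sum to at most its first Φ entries.  The
-- theorem uses D itself as witness both ways.

open import Defs
open import Data.Nat using (ℕ; zero; suc; _≤_; _<_; _≥_; _+_; z≤n; s≤s)
open import Data.Nat.Properties
  using (≤-refl; ≤-trans; ≤-reflexive; +-suc; +-identityʳ; +-mono-≤; m≤m+n; m⊓n≤m; <-irrefl; ≤-decTotalOrder; module ≤-Reasoning)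
open import Data.Nat.ListAction using (sum)
open import Data.Bool as Bool using (true; false)
open import Data.Fin using (Fin)
open import Data.Fin.Properties using (any?)
open import Data.Fin.Subset
open import Data.Fin.Subset.Properties
  using (_∈?_; nonempty?; ∉⊥; ∣p∣≤n; ∣⊥∣≡0; ∣⁅x⁆∣≡1; x∈⁅x⁆; x∈⁅y⁆⇒x≡y; p⊆q⇒∣p∣≤∣q∣; p⊂q⇒∣p∣<∣q∣; ⊆-antisym; Empty-unique; x∈p∪q⁺; x∈p∪q⁻; x∈p∩q⁺; x∈p∩q⁻; p⊆p∪q; x∉p⇒x∈∁p; x∈∁p⇒x∉p)
open import Data.Vec using ([]; _∷_; tabulate)
open import Data.Vec.Properties using (lookup⇒[]=; []=⇒lookup; lookup∘tabulate; ≡-dec)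
open import Data.List using (List; []; _∷_; map; filter; take; length; allFin; deduplicate)
open import Data.List.Properties using (length-map; length-take; take-map)
open import Data.List.Membership.Propositional using () renaming (_∈_ to _∈ₗ_)
open import Data.List.Membership.Propositional.Properties
  using (∈-map⁺; ∈-map⁻; ∈-filter⁺; ∈-filter⁻; ∈-allFin; ∈-deduplicate⁺; ∈-deduplicate⁻)
open import Data.List.Relation.Unary.Any using (here; there)
open import Data.List.Relation.Unary.All as All using (All; []; _∷_)
open import Data.List.Relation.Unary.All.Properties as AllP using (all-filter)
open import Data.List.Relation.Unary.AllPairs as AllPairs using (AllPairs; []; _∷_)
import Data.List.Relation.Unary.AllPairs.Properties as AllPairsP
open import Data.List.Relation.Unary.Linked.Properties using (Linked⇒AllPairs)
open import Data.List.Relation.Unary.Unique.Propositional using (Unique)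
import Data.List.Relation.Unary.Unique.Propositional.Properties as UniqueP
open import Data.List.Relation.Unary.Unique.DecPropositional.Properties using (deduplicate-!)
open import Data.List.Relation.Binary.Sublist.Propositional using () renaming (_⊆_ to _⊑_)
open import Data.List.Relation.Binary.Sublist.Propositional.Properties
  using (All-resp-⊆; ∷⁻; filter-⊆)
  renaming (map⁺ to sublist-map⁺)
open import Data.List.Relation.Binary.Permutation.Propositional using (↭-sym; ↭⇒↭ₛ)
open import Data.List.Relation.Binary.Permutation.Propositional.Properties using (∈-resp-↭)
import Data.List.Relation.Binary.Permutation.Setoid.Properties as PermutationS
open import Data.Product using (∃; _×_; _,_; proj₁; proj₂)
open import Data.Empty using (⊥-elim)
open import Data.Sum using (inj₁; inj₂; _⊎_)
open import Function using (_∘_)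
open import Function.Bundles using (_⇔_; mk⇔; Equivalence)
open import Relation.Unary using (Pred; Decidable)
open import Relation.Binary.Bundles using (DecTotalOrder)
open import Relation.Nullary using (yes; no; does; ¬?)
open import Relation.Nullary.Decidable using (dec-true; decidable-stable; _×-dec_)
open import Relation.Binary.PropositionalEquality
  using (_≡_; _≢_; refl; sym; trans; cong; subst; setoid; module ≡-Reasoning)
import Relation.Binary.Construct.On as On
import Relation.Binary.Construct.Flip.EqAndOrd as Flip

open Equivalence using (to; from)

private
  variable
    m : ℕ

⟦_⟧ : ∀ {p} {P : Pred (Fin m) p} → Decidable P → Subset m
⟦ P? ⟧ = tabulate (λ x → does (P? x))

∈⟦⟧⁺ : ∀ {p} {P : Pred (Fin m) p} (P? : Decidable P) {x} → P x → x ∈ ⟦ P? ⟧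
∈⟦⟧⁺ P? {x} px = lookup⇒[]= x _ (trans (lookup∘tabulate _ x) (dec-true (P? x) px))

∈⟦⟧⁻ : ∀ {p} {P : Pred (Fin m) p} (P? : Decidable P) {x} → x ∈ ⟦ P? ⟧ → P x
∈⟦⟧⁻ P? {x} x∈ with P? x | trans (sym (lookup∘tabulate _ x)) ([]=⇒lookup x∈)
... | yes px | _  = px
... | no _   | ()

∣p∪q∣+∣p∩q∣≡∣p∣+∣q∣ : (p q : Subset m) → ∣ p ∪ q ∣ + ∣ p ∩ q ∣ ≡ ∣ p ∣ + ∣ q ∣
∣p∪q∣+∣p∩q∣≡∣p∣+∣q∣ []          []          = refl
∣p∪q∣+∣p∩q∣≡∣p∣+∣q∣ (true ∷ p)  (true ∷ q)  = cong suc (begin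
  ∣ p ∪ q ∣ + suc ∣ p ∩ q ∣   ≡⟨ +-suc ∣ p ∪ q ∣ ∣ p ∩ q ∣ ⟩
  suc (∣ p ∪ q ∣ + ∣ p ∩ q ∣) ≡⟨ cong suc (∣p∪q∣+∣p∩q∣≡∣p∣+∣q∣ p q) ⟩
  suc (∣ p ∣ + ∣ q ∣)         ≡⟨ +-suc ∣ p ∣ ∣ q ∣ ⟨
  ∣ p ∣ + suc ∣ q ∣           ∎)
  where open ≡-Reasoning
∣p∪q∣+∣p∩q∣≡∣p∣+∣q∣ (true ∷ p)  (false ∷ q) = cong suc (∣p∪q∣+∣p∩q∣≡∣p∣+∣q∣ p q)
∣p∪q∣+∣p∩q∣≡∣p∣+∣q∣ (false ∷ p) (true ∷ q)  =
  trans (cong suc (∣p∪q∣+∣p∩q∣≡∣p∣+∣q∣ p q)) (sym (+-suc ∣ p ∣ ∣ q ∣))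
∣p∪q∣+∣p∩q∣≡∣p∣+∣q∣ (false ∷ p) (false ∷ q) = ∣p∪q∣+∣p∩q∣≡∣p∣+∣q∣ p q

∣p∪q∣≤∣p∣+∣q∣ : (p q : Subset m) → ∣ p ∪ q ∣ ≤ ∣ p ∣ + ∣ q ∣
∣p∪q∣≤∣p∣+∣q∣ p q = ≤-trans (m≤m+n ∣ p ∪ q ∣ ∣ p ∩ q ∣) (≤-reflexive (∣p∪q∣+∣p∩q∣≡∣p∣+∣q∣ p q))

Disjoint : Subset m → Subset m → Set
Disjoint p q = Empty (p ∩ q)

∣p∪q∣≡∣p∣+∣q∣ : (p q : Subset m) → Disjoint p q → ∣ p ∪ q ∣ ≡ ∣ p ∣ + ∣ q ∣
∣p∪q∣≡∣p∣+∣q∣ {m} p q p#q = begin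
  ∣ p ∪ q ∣             ≡⟨ +-identityʳ ∣ p ∪ q ∣ ⟨
  ∣ p ∪ q ∣ + 0         ≡⟨ cong (∣ p ∪ q ∣ +_) ∣p∩q∣≡0 ⟨
  ∣ p ∪ q ∣ + ∣ p ∩ q ∣ ≡⟨ ∣p∪q∣+∣p∩q∣≡∣p∣+∣q∣ p q ⟩
  ∣ p ∣ + ∣ q ∣         ∎
  where
  open ≡-Reasoning
  ∣p∩q∣≡0 : ∣ p ∩ q ∣ ≡ 0
  ∣p∩q∣≡0 = trans (cong ∣_∣ (Empty-unique p#q)) (∣⊥∣≡0 m)

-- A nonempty set contains the singleton of any of its points.
nonempty⇒∣p∣≥1 : {p : Subset m} → Nonempty p → 1 ≤ ∣ p ∣
nonempty⇒∣p∣≥1 {p = p} (x , x∈p) =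
  ≤-trans (≤-reflexive (sym (∣⁅x⁆∣≡1 x))) (p⊆q⇒∣p∣≤∣q∣ ⁅x⁆⊆p)
  where
  ⁅x⁆⊆p : ⁅ x ⁆ ⊆ p
  ⁅x⁆⊆p y∈⁅x⁆ = subst (_∈ p) (sym (x∈⁅y⁆⇒x≡y x y∈⁅x⁆)) x∈p

∈⋃⁺ : {Cs : List (Subset m)} {C : Subset m} {x : Fin m} → C ∈ₗ Cs → x ∈ C → x ∈ ⋃ Cs
∈⋃⁺ (here refl) x∈C = x∈p∪q⁺ (inj₁ x∈C)
∈⋃⁺ (there C∈)  x∈C = x∈p∪q⁺ (inj₂ (∈⋃⁺ C∈ x∈C))

∈⋃⁻ : (Cs : List (Subset m)) {x : Fin m} → x ∈ ⋃ Cs → ∃ λ C → C ∈ₗ Cs × x ∈ C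
∈⋃⁻ []       x∈ = ⊥-elim (∉⊥ x∈)
∈⋃⁻ (C ∷ Cs) x∈ with x∈p∪q⁻ C (⋃ Cs) x∈
... | inj₁ x∈C  = C , here refl , x∈C
... | inj₂ x∈Cs with ∈⋃⁻ Cs x∈Cs
...   | C′ , C′∈ , x∈C′ = C′ , there C′∈ , x∈C′

∣⋃∣≤sum : (Cs : List (Subset m)) → ∣ ⋃ Cs ∣ ≤ sum (map ∣_∣ Cs)
∣⋃∣≤sum {m} []       = ≤-reflexive (∣⊥∣≡0 m)
∣⋃∣≤sum     (C ∷ Cs) = ≤-trans (∣p∪q∣≤∣p∣+∣q∣ C (⋃ Cs)) (+-mono-≤ ≤-refl (∣⋃∣≤sum Cs))

∣⋃∣≡sum : (Cs : List (Subset m)) → AllPairs Disjoint Cs → ∣ ⋃ Cs ∣ ≡ sum (map ∣_∣ Cs)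
∣⋃∣≡sum {m} []       []          = ∣⊥∣≡0 m
∣⋃∣≡sum     (C ∷ Cs) (C#Cs ∷ Cs!) =
  trans (∣p∪q∣≡∣p∣+∣q∣ C (⋃ Cs) C#⋃Cs) (cong (∣ C ∣ +_) (∣⋃∣≡sum Cs Cs!))
  where
  C#⋃Cs : Disjoint C (⋃ Cs)
  C#⋃Cs (x , x∈C∩⋃Cs) with x∈p∩q⁻ C (⋃ Cs) x∈C∩⋃Cs
  ... | x∈C , x∈⋃Cs with ∈⋃⁻ Cs x∈⋃Cs
  ...   | C′ , C′∈ , x∈C′ = All.lookup C#Cs C′∈ (x , x∈p∩q⁺ (x∈C , x∈C′))

length≤∣⋃∣ : (Cs : List (Subset m)) → AllPairs Disjoint Cs → All Nonempty Cs → length Cs ≤ ∣ ⋃ Cs ∣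
length≤∣⋃∣ Cs Cs! nonempty = ≤-trans (length≤sum Cs nonempty) (≤-reflexive (sym (∣⋃∣≡sum Cs Cs!)))
  where
  length≤sum : (Cs : List (Subset m)) → All Nonempty Cs → length Cs ≤ sum (map ∣_∣ Cs)
  length≤sum []       []       = z≤n
  length≤sum (C ∷ Cs) (ne ∷ nes) = +-mono-≤ (nonempty⇒∣p∣≥1 ne) (length≤sum Cs nes)

Meets : Subset m → Subset m → Set
Meets I C = Nonempty (C ∩ I)

meets? : (I : Subset m) → Decidable (Meets I)
meets? I C = nonempty? (C ∩ I)

length-meeting≤ : (I : Subset m) (Cs : List (Subset m)) → AllPairs Disjoint Cs →
                  length (filter (meets? I) Cs) ≤ ∣ I ∣
length-meeting≤ {m} I Cs Cs! = begin
  length Ms                ≡⟨ length-map (_∩ I) Ms ⟨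
  length (map (_∩ I) Ms)   ≤⟨ length≤∣⋃∣ (map (_∩ I) Ms) traces! traces-nonempty ⟩
  ∣ ⋃ (map (_∩ I) Ms) ∣   ≤⟨ p⊆q⇒∣p∣≤∣q∣ ⋃traces⊆I ⟩
  ∣ I ∣                    ∎
  where
  open ≤-Reasoning
  Ms : List (Subset m)
  Ms = filter (meets? I) Cs
  shrink : ∀ {C C′} → Disjoint C C′ → Disjoint (C ∩ I) (C′ ∩ I)
  shrink {C} {C′} C#C′ (x , x∈) =
    C#C′ (x , x∈p∩q⁺ (proj₁ (x∈p∩q⁻ C I (proj₁ (x∈p∩q⁻ (C ∩ I) (C′ ∩ I) x∈))) ,
                      proj₁ (x∈p∩q⁻ C′ I (proj₂ (x∈p∩q⁻ (C ∩ I) (C′ ∩ I) x∈)))))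
  traces! : AllPairs Disjoint (map (_∩ I) Ms)
  traces! = AllPairsP.map⁺ (AllPairs.map shrink (AllPairsP.filter⁺ (meets? I) Cs!))
  traces-nonempty : All Nonempty (map (_∩ I) Ms)
  traces-nonempty = AllP.map⁺ (all-filter (meets? I) Cs)
  ⋃traces⊆I : ⋃ (map (_∩ I) Ms) ⊆ I
  ⋃traces⊆I x∈ with ∈⋃⁻ (map (_∩ I) Ms) x∈
  ... | _ , C∩I∈ , x∈C∩I with ∈-map⁻ (_∩ I) C∩I∈
  ...   | C , _ , refl = proj₂ (x∈p∩q⁻ C I x∈C∩I)

hittingSet : (Cs : List (Subset m)) → All Nonempty Cs →
             ∃ λ I → ∣ I ∣ ≤ length Cs × I ⊆ ⋃ Cs × All (Meets I) Cs
hittingSet {m} []       []                   = ⊥ , ≤-reflexive (∣⊥∣≡0 m) , (⊥-elim ∘ ∉⊥) , []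
hittingSet     (C ∷ Cs) ((x , x∈C) ∷ nonempty) with hittingSet Cs nonempty
... | I , ∣I∣≤ , I⊆⋃Cs , hits =
  ⁅ x ⁆ ∪ I , size , ⊆⋃ , (x , x∈p∩q⁺ (x∈C , x∈p∪q⁺ (inj₁ (x∈⁅x⁆ x)))) ∷ All.map enlarge hits
  where
  size : ∣ ⁅ x ⁆ ∪ I ∣ ≤ suc (length Cs)
  size = ≤-trans (∣p∪q∣≤∣p∣+∣q∣ ⁅ x ⁆ I)
                 (subst (λ k → k + ∣ I ∣ ≤ suc (length Cs)) (sym (∣⁅x⁆∣≡1 x)) (s≤s ∣I∣≤))
  ⊆⋃ : ⁅ x ⁆ ∪ I ⊆ C ∪ ⋃ Cs
  ⊆⋃ y∈ with x∈p∪q⁻ ⁅ x ⁆ I y∈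
  ... | inj₁ y∈⁅x⁆ = x∈p∪q⁺ (inj₁ (subst (_∈ C) (sym (x∈⁅y⁆⇒x≡y x y∈⁅x⁆)) x∈C))
  ... | inj₂ y∈I   = x∈p∪q⁺ (inj₂ (I⊆⋃Cs y∈I))
  enlarge : ∀ {C′} → Meets I C′ → Meets (⁅ x ⁆ ∪ I) C′
  enlarge {C′} (y , y∈) with x∈p∩q⁻ C′ I y∈
  ... | y∈C′ , y∈I = y , x∈p∩q⁺ (y∈C′ , x∈p∪q⁺ (inj₂ y∈I))

iterate : (Subset m → Subset m) → Subset m → ℕ → Subset m
iterate f S zero    = S
iterate f S (suc k) = f (iterate f S k)

Inflationary : (Subset m → Subset m) → Set
Inflationary f = ∀ S → S ⊆ f S

⊆-iterate : {f : Subset m → Subset m} → Inflationary f → ∀ S k → S ⊆ iterate f S k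
⊆-iterate infl S zero    x∈ = x∈
⊆-iterate infl S (suc k) x∈ = infl (iterate _ S k) (⊆-iterate infl S k x∈)

closed-or-grows : {f : Subset m → Subset m} → Inflationary f →
                  ∀ R → f R ⊆ R ⊎ ∣ R ∣ < ∣ f R ∣
closed-or-grows {f = f} infl R with any? (λ x → (x ∈? f R) ×-dec ¬? (x ∈? R))
... | yes (x , x∈fR , x∉R) = inj₂ (p⊂q⇒∣p∣<∣q∣ (infl R , x , x∈fR , x∉R))
... | no nothing-new        =
  inj₁ (λ {x} x∈fR → decidable-stable (x ∈? R) (λ x∉R → nothing-new (x , x∈fR , x∉R)))

closes-or-grows : {f : Subset m → Subset m} → Inflationary f → ∀ S k →
                  (∃ λ j → f (iterate f S j) ⊆ iterate f S j) ⊎ k ≤ ∣ iterate f S k ∣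
closes-or-grows infl S zero    = inj₂ z≤n
closes-or-grows infl S (suc k) with closes-or-grows infl S k
... | inj₁ closed = inj₁ closed
... | inj₂ k≤ with closed-or-grows infl (iterate _ S k)
...   | inj₁ closed = inj₁ (k , closed)
...   | inj₂ bigger = inj₂ (≤-trans (s≤s k≤) bigger)

-- Iterating an inflationary operator on subsets of an m-element set reaches a
-- closed set, since the (m + 1)-st iterate cannot have more than m elements.
iterate-closes : {f : Subset m → Subset m} → Inflationary f →
                 ∀ S → ∃ λ j → f (iterate f S j) ⊆ iterate f S j
iterate-closes {m} {f} infl S with closes-or-grows infl S (suc m)
... | inj₁ closed = closed
... | inj₂ tooBig = ⊥-elim (<-irrefl refl (≤-trans tooBig (∣p∣≤n (iterate f S (suc m)))))

-- In a non-increasing list xs, any sublist with at most k entries sums to at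
-- most the first k entries: its i-th entry is bounded by the i-th entry of xs.
sum-sublist≤sum-take : ∀ k {xs ys : List ℕ} → AllPairs _≥_ xs → ys ⊑ xs → length ys ≤ k →
                       sum ys ≤ sum (take k xs)
sum-sublist≤sum-take k       {ys = []}        _ _   _  = z≤n
sum-sublist≤sum-take zero    {ys = _ ∷ _}     _ _   ()
sum-sublist≤sum-take (suc k) {[]}    {_ ∷ _}  _ ()  _
sum-sublist≤sum-take (suc k) {x ∷ xs} {y ∷ ys} (x≥xs ∷ sorted) ys⊑ (s≤s len) =
  +-mono-≤ y≤x (sum-sublist≤sum-take k sorted (∷⁻ ys⊑) len)
  where
  y≤x : y ≤ x
  y≤x = All.head (All-resp-⊆ ys⊑ (≤-refl ∷ x≥xs))

bySizeDescending : ℕ → DecTotalOrder _ _ _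
bySizeDescending m = On.decTotalOrder (Flip.decTotalOrder ≤-decTotalOrder) (∣_∣ {m})

module _ {n : ℕ} (G : Graph n) (D : Subset n) where

  _⇝_ : Fin n → Fin n → Set
  u ⇝ v = Conn G D u v

  ⇝-avoids : ∀ {u v} → u ⇝ v → v ∉ D
  ⇝-avoids (here v∉D)     = v∉D
  ⇝-avoids (step _ _ v∉D) = v∉D

  ⇝-trans : ∀ {u v w} → u ⇝ v → v ⇝ w → u ⇝ w
  ⇝-trans u⇝v (here _)          = u⇝v
  ⇝-trans u⇝v (step v⇝w vw w∉D) = step (⇝-trans u⇝v v⇝w) vw w∉D

  ⇝-sym : ∀ {u v} → u ⇝ v → v ⇝ u
  ⇝-sym (here u∉D) = here u∉D
  ⇝-sym {v = w} (step {v = v} u⇝v vw w∉D) = ⇝-trans w⇝v (⇝-sym u⇝v)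
    where
    w⇝v : w ⇝ v
    w⇝v = step (here w∉D) (trans (adj-sym G w v) vw) (⇝-avoids u⇝v)

  module _ {C : Subset n} (isC : IsComponent G D C) where

    private
      reached : ∀ {v} → v ∈ C → proj₁ isC ⇝ v
      reached {v} = to (proj₂ (proj₂ isC) v)
      reach : ∀ {v} → proj₁ isC ⇝ v → v ∈ C
      reach {v} = from (proj₂ (proj₂ isC) v)

    root∈ : proj₁ isC ∈ C
    root∈ = reach (here (proj₁ (proj₂ isC)))

    component-closed : ∀ {x v} → x ∈ C → x ⇝ v → v ∈ C
    component-closed x∈C x⇝v = reach (⇝-trans (reached x∈C) x⇝v)

    component-connected : ∀ {x y} → x ∈ C → y ∈ C → x ⇝ y
    component-connected x∈C y∈C = ⇝-trans (⇝-sym (reached x∈C)) (reached y∈C)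

    component-avoids : ∀ {x} → x ∈ C → x ∉ D
    component-avoids x∈C = ⇝-avoids (reached x∈C)

  components-meet⇒≡ : ∀ {C C′ x} → IsComponent G D C → IsComponent G D C′ → x ∈ C → x ∈ C′ → C ≡ C′
  components-meet⇒≡ isC isC′ x∈C x∈C′ = ⊆-antisym (C⊆C′ isC isC′ x∈C x∈C′) (C⊆C′ isC′ isC x∈C′ x∈C)
    where
    C⊆C′ : ∀ {C C′ x} → IsComponent G D C → IsComponent G D C′ → x ∈ C → x ∈ C′ → C ⊆ C′
    C⊆C′ isC isC′ x∈C x∈C′ v∈C = component-closed isC′ x∈C′ (component-connected isC x∈C v∈C)

  components-disjoint : ∀ {Cs} → All (IsComponent G D) Cs → Unique Cs → AllPairs Disjoint Cs
  components-disjoint []            []           = []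
  components-disjoint {C ∷ _} (isC ∷ areCs) (C∉Cs ∷ Cs!) =
    All.zipWith disjoint (areCs , C∉Cs) ∷ components-disjoint areCs Cs!
    where
    disjoint : ∀ {C′} → IsComponent G D C′ × C ≢ C′ → Disjoint C C′
    disjoint {C′} (isC′ , C≢C′) (x , x∈) =
      C≢C′ (components-meet⇒≡ isC isC′ (proj₁ (x∈p∩q⁻ C C′ x∈)) (proj₂ (x∈p∩q⁻ C C′ x∈)))

  Frontier : Subset n → Fin n → Set
  Frontier S w = w ∉ D × ∃ λ v → v ∈ S × adj G v w ≡ true

  frontier? : ∀ S → Decidable (Frontier S)
  frontier? S w = ¬? (w ∈? D) ×-dec any? (λ v → (v ∈? S) ×-dec (adj G v w Bool.≟ true))

  expand : Subset n → Subset n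
  expand S = S ∪ ⟦ frontier? S ⟧

  expand-inflationary : Inflationary expand
  expand-inflationary S = p⊆p∪q ⟦ frontier? S ⟧

  closingRound : Fin n → ℕ
  closingRound u = proj₁ (iterate-closes expand-inflationary ⁅ u ⁆)

  componentOf : Fin n → Subset n
  componentOf u = iterate expand ⁅ u ⁆ (closingRound u)

  reached⇒⇝ : ∀ {u v} → u ∉ D → ∀ k → v ∈ iterate expand ⁅ u ⁆ k → u ⇝ v
  reached⇒⇝ u∉D zero    v∈ rewrite x∈⁅y⁆⇒x≡y _ v∈ = here u∉D
  reached⇒⇝ u∉D (suc k) v∈ with x∈p∪q⁻ _ _ v∈
  ... | inj₁ v∈R = reached⇒⇝ u∉D k v∈R
  ... | inj₂ v∈F with ∈⟦⟧⁻ (frontier? _) v∈F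
  ...   | v∉D , w , w∈R , wv = step (reached⇒⇝ u∉D k w∈R) wv v∉D

  ⇝⇒∈componentOf : ∀ {u v} → u ⇝ v → v ∈ componentOf u
  ⇝⇒∈componentOf {u} (here _) = ⊆-iterate expand-inflationary ⁅ u ⁆ (closingRound u) (x∈⁅x⁆ u)
  ⇝⇒∈componentOf {u} (step u⇝v vw w∉D) =
    proj₂ (iterate-closes expand-inflationary ⁅ u ⁆)
      (x∈p∪q⁺ (inj₂ (∈⟦⟧⁺ (frontier? _) (w∉D , _ , ⇝⇒∈componentOf u⇝v , vw))))

  componentOf-isComponent : ∀ {u} → u ∉ D → IsComponent G D (componentOf u)
  componentOf-isComponent {u} u∉D = u , u∉D , λ v → mk⇔ (reached⇒⇝ u∉D (closingRound u)) ⇝⇒∈componentOf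

  component≡componentOf : ∀ {C} (isC : IsComponent G D C) → C ≡ componentOf (proj₁ isC)
  component≡componentOf isC@(r , r∉D , _) =
    components-meet⇒≡ isC (componentOf-isComponent r∉D) (root∈ isC) (⇝⇒∈componentOf (here r∉D))

  outside? : Decidable (_∉ D)
  outside? u = ¬? (u ∈? D)

  candidates : List (Subset n)
  candidates = map componentOf (filter outside? (allFin n))

  ∈candidates⇔ : ∀ C → C ∈ₗ candidates ⇔ IsComponent G D C
  ∈candidates⇔ C = mk⇔ candidate⇒component component⇒candidate
    where
    candidate⇒component : C ∈ₗ candidates → IsComponent G D C
    candidate⇒component C∈ with ∈-map⁻ componentOf C∈
    ... | u , u∈ , refl = componentOf-isComponent (proj₂ (∈-filter⁻ outside? {xs = allFin n} u∈))
    component⇒candidate : IsComponent G D C → C ∈ₗ candidates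
    component⇒candidate isC@(r , r∉D , _) =
      subst (_∈ₗ candidates) (sym (component≡componentOf isC))
        (∈-map⁺ componentOf (∈-filter⁺ outside? (∈-allFin r) r∉D))

  sortedComponentList : ∃ (IsSortedComponentList G D)
  sortedComponentList =
    sort distinct , unique , (λ C → mk⇔ (⇒component C) (⇐component C)) , sort-↗ distinct
    where
    open import Data.List.Sort (bySizeDescending n) using (sort; sort-↭; sort-↗)
    distinct : List (Subset n)
    distinct = deduplicate (≡-dec Bool._≟_) candidates
    unique : Unique (sort distinct)
    unique = PermutationS.Unique-resp-↭ (setoid (Subset n)) (↭⇒↭ₛ (↭-sym (sort-↭ distinct)))
               (deduplicate-! (≡-dec Bool._≟_) candidates)
    ⇒component : ∀ C → C ∈ₗ sort distinct → IsComponent G D C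
    ⇒component C C∈ =
      to (∈candidates⇔ C) (∈-deduplicate⁻ (≡-dec Bool._≟_) candidates (∈-resp-↭ (sort-↭ distinct) C∈))
    ⇐component : ∀ C → IsComponent G D C → C ∈ₗ sort distinct
    ⇐component C isC =
      ∈-resp-↭ (↭-sym (sort-↭ distinct)) (∈-deduplicate⁺ (≡-dec Bool._≟_) (from (∈candidates⇔ C) isC))

  ⋃components⊆∁D : ∀ {Cs} → All (IsComponent G D) Cs → ⋃ Cs ⊆ ∁ D
  ⋃components⊆∁D {Cs} areCs x∈ with ∈⋃⁻ Cs x∈
  ... | C , C∈ , x∈C = x∉p⇒x∈∁p (component-avoids (All.lookup areCs C∈) x∈C)

  hit-components-infected : ∀ {Cs I} → All (IsComponent G D) Cs → I ⊆ ⋃ Cs → All (Meets I) Cs →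
                            IsInfSet G D I (⋃ Cs)
  hit-components-infected {Cs} {I} areCs I⊆⋃Cs hits v = mk⇔ ⋃⇒infected infected⇒⋃
    where
    ⋃⇒infected : v ∈ ⋃ Cs → Infected G D I v
    ⋃⇒infected v∈ with ∈⋃⁻ Cs v∈
    ... | C , C∈ , v∈C with All.lookup hits C∈
    ...   | i , i∈C∩I =
      i , proj₂ (x∈p∩q⁻ C I i∈C∩I) ,
      component-connected (All.lookup areCs C∈) (proj₁ (x∈p∩q⁻ C I i∈C∩I)) v∈C
    infected⇒⋃ : Infected G D I v → v ∈ ⋃ Cs
    infected⇒⋃ (i , i∈I , i⇝v) with ∈⋃⁻ Cs (I⊆⋃Cs i∈I)
    ... | C , C∈ , i∈C = ∈⋃⁺ C∈ (component-closed (All.lookup areCs C∈) i∈C i⇝v)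

  infected⊆⋃meeting : ∀ {L I S} → (∀ C → IsComponent G D C → C ∈ₗ L) → I ⊆ ∁ D →
                      IsInfSet G D I S → S ⊆ ⋃ (filter (meets? I) L)
  infected⊆⋃meeting {I = I} complete I⊆∁D isInf v∈S with to (isInf _) v∈S
  ... | i , i∈I , i⇝v =
    ∈⋃⁺ (∈-filter⁺ (meets? I) (complete _ isC) (i , x∈p∩q⁺ (root∈ isC , i∈I))) (⇝⇒∈componentOf i⇝v)
    where
    isC : IsComponent G D (componentOf i)
    isC = componentOf-isComponent (x∈∁p⇒x∉p (I⊆∁D i∈I))

  attackBound⇒componentSum : ∀ {Φ K Cs} → (∀ I → I ⊆ ∁ D → ∣ I ∣ ≤ Φ → InfAtMost G D I K) →
                             All (IsComponent G D) Cs → Unique Cs → length Cs ≤ Φ →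
                             sum (map ∣_∣ Cs) ≤ K
  attackBound⇒componentSum {Φ} {K} {Cs} bound areCs Cs! ∣Cs∣≤Φ
    with hittingSet Cs (All.map (λ isC → proj₁ isC , root∈ isC) areCs)
  ... | I , ∣I∣≤∣Cs∣ , I⊆⋃Cs , hits = begin
    sum (map ∣_∣ Cs) ≡⟨ ∣⋃∣≡sum Cs (components-disjoint areCs Cs!) ⟨
    ∣ ⋃ Cs ∣         ≤⟨ bound I I⊆∁D (≤-trans ∣I∣≤∣Cs∣ ∣Cs∣≤Φ) (⋃ Cs) (hit-components-infected areCs I⊆⋃Cs hits) ⟩
    K                ∎
    where
    open ≤-Reasoning
    I⊆∁D : I ⊆ ∁ D
    I⊆∁D = ⋃components⊆∁D areCs ∘ I⊆⋃Cs

  attackBound⇒topSum : ∀ Φ K → (∀ I → I ⊆ ∁ D → ∣ I ∣ ≤ Φ → InfAtMost G D I K) → TopSumAtMost G D Φ K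
  attackBound⇒topSum Φ K bound L (L! , L⇔ , _) =
    attackBound⇒componentSum bound
      (AllP.take⁺ Φ (All.tabulate (to (L⇔ _))))
      (UniqueP.take⁺ Φ L!)
      (≤-trans (≤-reflexive (length-take Φ L)) (m⊓n≤m Φ (length L)))

  topSum⇒attackBound : ∀ Φ K → TopSumAtMost G D Φ K → ∀ I → I ⊆ ∁ D → ∣ I ∣ ≤ Φ → InfAtMost G D I K
  topSum⇒attackBound Φ K top I I⊆∁D ∣I∣≤Φ S isInf = begin
    ∣ S ∣                      ≤⟨ p⊆q⇒∣p∣≤∣q∣ (infected⊆⋃meeting (λ C → from (L⇔ C)) I⊆∁D isInf) ⟩
    ∣ ⋃ M ∣                    ≤⟨ ∣⋃∣≤sum M ⟩
    sum (map ∣_∣ M)            ≤⟨ sum-sublist≤sum-take Φ sizes-sorted (sublist-map⁺ ∣_∣ (filter-⊆ (meets? I) L)) ∣M∣≤Φ ⟩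
    sum (take Φ (map ∣_∣ L))   ≡⟨ cong sum (take-map Φ L) ⟩
    sum (map ∣_∣ (take Φ L))   ≤⟨ top L sorted ⟩
    K                          ∎
    where
    open ≤-Reasoning
    L : List (Subset n)
    L = proj₁ sortedComponentList
    sorted : IsSortedComponentList G D L
    sorted = proj₂ sortedComponentList
    L⇔ : ∀ C → C ∈ₗ L ⇔ IsComponent G D C
    L⇔ = proj₁ (proj₂ sorted)
    M : List (Subset n)
    M = filter (meets? I) L
    sizes-sorted : AllPairs _≥_ (map ∣_∣ L)
    sizes-sorted = AllPairsP.map⁺ (Linked⇒AllPairs (λ b≤a c≤b → ≤-trans c≤b b≤a) (proj₂ (proj₂ sorted)))
    ∣M∣≤Φ : length (map ∣_∣ M) ≤ Φ
    ∣M∣≤Φ = ≤-trans (≤-reflexive (length-map ∣_∣ M))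
              (≤-trans (length-meeting≤ I L (components-disjoint (All.tabulate (to (L⇔ _))) (proj₁ sorted)))
                       ∣I∣≤Φ)

lemma3 : (n : ℕ) (G : Graph n) (Ω Φ K : ℕ) → Ω + Φ ≤ n →
         (VaccinationAttack G Ω Φ K ⇔ MinMaxΦC G Ω Φ K)
lemma3 n G Ω Φ K _ =
  mk⇔ (λ (D , ∣D∣≤Ω , bound) → D , ∣D∣≤Ω , attackBound⇒topSum G D Φ K bound)
      (λ (D , ∣D∣≤Ω , top)   → D , ∣D∣≤Ω , topSum⇒attackBound G D Φ K top)
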